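{- Let $n\ge1$, let $\mathcal{B}_1,\mathcal{B}_2$ be non-trivial Boolean algebras and let $h:\mathcal{A}^{\mathcal{B}_1}_{C_n}\to\mathcal{A}^{\mathcal{B}_2}_{C_n}$ be a homomorphism of $\Sigma$-multialgebras. Then there exists a function $g:|\mathcal{B}_1|\to|\mathcal{B}_2|$ such that $h(z)_{[1]}=g(z_{[1]})$ and $h(z)_{[2]}=g(z_{[2]})$ for every $z\in B^{\mathcal{B}_1}_n$.
   Context: $\Sigma$ is the signature with unary $\neg$ and binary $\wedge,\vee,\to$. For a non-trivial Boolean algebra $\mathcal{B}$ (complement $\sim$, $a\to b=\sim a\vee b$), $n\ge1$, and $z\in|\mathcal{B}|^{n+1}$ with coordinates $z_{[i]}$: $B^{\mathcal{B}}_n=\{z: (\bigwedge_{i=1}^k z_{[i]})\vee z_{[k+1]}=1 \ \forall 1\le k\le n\}$, $Boo^{\mathcal{B}}_n=\{z\in B^{\mathcal{B}}_n:z_{[1]}\wedge z_{[2]}=0\}$. $\mathcal{A}^{\mathcal{B}}_{C_n}$ is the $\Sigma$-multialgebra on $B^{\mathcal{B}}_n$ with $\tilde\neg z=\{w\in B^{\mathcal{B}}_n: w_{[1]}=z_{[2]}, w_{[2]}\le z_{[1]}\}$ and for $\#\in\{\wedge,\vee,\to\}$, $z\tilde\# w=\{u\in Boo^{\mathcal{B}}_n:u_{[1]}=z_{[1]}\#w_{[1]}\}$ if $z,w\in Boo^{\mathcal{B}}_n$, else $\{u\in B^{\mathcal{B}}_n:u_{[1]}=z_{[1]}\#w_{[1]}\}$.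 A homomorphism of $\Sigma$-multialgebras $h$ satisfies $h[\tilde\neg z]\subseteq\tilde\neg h(z)$ and $h[z\tilde\#w]\subseteq h(z)\tilde\#h(w)$ for all $z,w$ and $\#$. -}

module Defs where

open import Level using (Level; _⊔_)
open import Data.Nat using (ℕ; suc)
open import Data.Fin using (Fin; zero; suc; inject₁)
open import Data.Product using (Σ; _×_; proj₁)
open import Relation.Nullary renaming (¬_ to Not)
open import Algebra.Lattice.Bundles using (BooleanAlgebra)

NonTrivial : ∀ {c ℓ} → BooleanAlgebra c ℓ → Set ℓ
NonTrivial B = Not (⊤ ≈ ⊥) where open BooleanAlgebra B renaming (¬_ to ∼_)

module _ {c ℓ} (B : BooleanAlgebra c ℓ) where
  open BooleanAlgebra B renaming (¬_ to ∼_)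

  _≤ᴮ_ : Carrier → Carrier → Set ℓ
  a ≤ᴮ b = (a ∧ b) ≈ a

  _⇒ᴮ_ : Carrier → Carrier → Carrier
  a ⇒ᴮ b = (∼ a) ∨ b

  -- Tuples z ∈ |B|^(n+1); coordinate z_[i] is z (i-1).
  -- prefixMeet z k = z_[1] ∧ ... ∧ z_[k+1]
  prefixMeet : ∀ {n} → (Fin (suc n) → Carrier) → Fin (suc n) → Carrier
  prefixMeet z zero = z zero
  prefixMeet {suc n} z (suc k) = z zero ∧ prefixMeet {n} (λ i → z (suc i)) k

  -- B_n : for all 1 ≤ k ≤ n, (⋀_{i=1}^k z_[i]) ∨ z_[k+1] = 1
  InB : (n : ℕ) → (Fin (suc n) → Carrier) → Set ℓ
  InB n z = (k : Fin n) → (prefixMeet z (inject₁ k) ∨ z (suc k)) ≈ ⊤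

-- Carrier of 𝒜^B_{C_n} for n = suc m (so n ≥ 1)
El : ∀ {c ℓ} → BooleanAlgebra c ℓ → ℕ → Set (c ⊔ ℓ)
El B m = Σ (Fin (suc (suc m)) → Carrier) (InB B (suc m))
  where open BooleanAlgebra B renaming (¬_ to ∼_)

module _ {c ℓ} (B : BooleanAlgebra c ℓ) (m : ℕ) where
  open BooleanAlgebra B renaming (¬_ to ∼_)

  c1 c2 : El B m → Carrier
  c1 z = proj₁ z zero
  c2 z = proj₁ z (suc zero)

  InBoo : El B m → Set ℓ
  InBoo z = (c1 z ∧ c2 z) ≈ ⊥

  NegRel : El B m → El B m → Set ℓ
  NegRel z w = (c1 w ≈ c2 z) × (_≤ᴮ_ B (c2 w) (c1 z))

data BinOp : Set where
  and or imp : BinOp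

evalOp : ∀ {c ℓ} (B : BooleanAlgebra c ℓ) → BinOp → _ → _ → _
evalOp B and a b = a ∧ b where open BooleanAlgebra B renaming (¬_ to ∼_)
evalOp B or  a b = a ∨ b where open BooleanAlgebra B renaming (¬_ to ∼_)
evalOp B imp a b = _⇒ᴮ_ B a b

module _ {c ℓ} (B : BooleanAlgebra c ℓ) (m : ℕ) where
  open BooleanAlgebra B renaming (¬_ to ∼_)

  BinRel : BinOp → El B m → El B m → El B m → Set ℓ
  BinRel o z w u =
    ((InBoo B m z × InBoo B m w) → InBoo B m u)
    × (c1 B m u ≈ evalOp B o (c1 B m z) (c1 B m w))

IsHom : ∀ {c₁ ℓ₁ c₂ ℓ₂} (B₁ : BooleanAlgebra c₁ ℓ₁) (B₂ : BooleanAlgebra c₂ ℓ₂)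
        (m : ℕ) → (El B₁ m → El B₂ m) → Set (c₁ ⊔ ℓ₁ ⊔ ℓ₂)
IsHom B₁ B₂ m h =
  ((z w : El B₁ m) → NegRel B₁ m z w → NegRel B₂ m (h z) (h w))
  × ((o : BinOp) (z w u : El B₁ m) → BinRel B₁ m o z w u
      → BinRel B₂ m o (h z) (h w) (h u))

-- Every element u of the carrier lies in ⊤̃ ∧̃ (u_[1], 1, …, 1), where ⊤̃ = (1, …, 1): since ⊤̃ ∉ Boo_n
-- only the first coordinate of the result is constrained, and it is 1 ∧ u_[1] = u_[1].  A homomorphism
-- therefore satisfies h(u)_[1] = h(⊤̃)_[1] ∧ h(u_[1], 1, …, 1)_[1], a function g of u_[1] alone.  The
-- second coordinate reduces to the first through the negation: (z_[2], z_[1], 1, …, 1) ∈ ¬̃ z, so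
-- h(z)_[2] is the first coordinate of its image, i.e. g(z_[2]).
module Submission where

open import Defs
open import Data.Nat using (ℕ; suc)
open import Data.Fin using (Fin; zero; suc)
open import Data.Product using (Σ; _×_; _,_; proj₁; proj₂)
open import Data.Empty using (⊥-elim)
open import Relation.Nullary using (¬_)
open import Algebra.Lattice.Bundles using (BooleanAlgebra)
import Algebra.Lattice.Properties.BooleanAlgebra as BooleanAlgebraProperties

module Elements {c ℓ} (B : BooleanAlgebra c ℓ) (m : ℕ) where
  open BooleanAlgebra B renaming (¬_ to ∼_)
  open BooleanAlgebraProperties B

  padded : Carrier → Carrier → Fin (suc (suc m)) → Carrier
  padded a b zero = a
  padded a b (suc zero) = b
  padded a b (suc (suc _)) = ⊤

  pair : (a b : Carrier) → (a ∨ b) ≈ ⊤ → El B m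
  pair a b a∨b≈⊤ = padded a b , padded∈B
    where
    padded∈B : InB B (suc m) (padded a b)
    padded∈B zero = a∨b≈⊤
    padded∈B (suc k) = ∨-zeroʳ _

  top : El B m
  top = pair ⊤ ⊤ (∨-zeroʳ ⊤)

  withFirst : Carrier → El B m
  withFirst a = pair a ⊤ (∨-zeroʳ a)

  swap : El B m → El B m
  swap z = pair (c2 B m z) (c1 B m z) (trans (∨-comm _ _) (proj₂ z zero))

  top∉Boo : NonTrivial B → ¬ InBoo B m top
  top∉Boo nonTrivial ⊤∧⊤≈⊥ = nonTrivial (trans (sym (∧-idem ⊤)) ⊤∧⊤≈⊥)

  ∈top∧withFirst : NonTrivial B → (u : El B m) → BinRel B m and top (withFirst (c1 B m u)) u
  ∈top∧withFirst nonTrivial u =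
    (λ (top∈Boo , _) → ⊥-elim (top∉Boo nonTrivial top∈Boo)) , sym (∧-identityˡ _)

  swap∈neg : (z : El B m) → NegRel B m z (swap z)
  swap∈neg z = refl , ∧-idem _

module Homomorphism {c₁ ℓ₁ c₂ ℓ₂} (B₁ : BooleanAlgebra c₁ ℓ₁) (B₂ : BooleanAlgebra c₂ ℓ₂) (m : ℕ)
  (nonTrivial₁ : NonTrivial B₁) (h : El B₁ m → El B₂ m) (hom : IsHom B₁ B₂ m h) where
  open BooleanAlgebra B₂ using (_≈_; _∧_; sym; trans)
  open Elements B₁ m

  coordinateMap : BooleanAlgebra.Carrier B₁ → BooleanAlgebra.Carrier B₂
  coordinateMap a = c1 B₂ m (h top) ∧ c1 B₂ m (h (withFirst a))

  c1-hom : (z : El B₁ m) → c1 B₂ m (h z) ≈ coordinateMap (c1 B₁ m z)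
  c1-hom z = proj₂ (proj₂ hom and top (withFirst (c1 B₁ m z)) z (∈top∧withFirst nonTrivial₁ z))

  c2-hom : (z : El B₁ m) → c2 B₂ m (h z) ≈ coordinateMap (c2 B₁ m z)
  c2-hom z = trans (sym (proj₁ (proj₁ hom z (swap z) (swap∈neg z)))) (c1-hom (swap z))

theorem6p4 : ∀ {c₁ ℓ₁ c₂ ℓ₂} (m : ℕ)
    (B₁ : BooleanAlgebra c₁ ℓ₁) (B₂ : BooleanAlgebra c₂ ℓ₂)
    → NonTrivial B₁ → NonTrivial B₂
    → (h : El B₁ m → El B₂ m) → IsHom B₁ B₂ m h
    → Σ (BooleanAlgebra.Carrier B₁ → BooleanAlgebra.Carrier B₂) λ g →
        (z : El B₁ m) →
          BooleanAlgebra._≈_ B₂ (c1 B₂ m (h z)) (g (c1 B₁ m z))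
          × BooleanAlgebra._≈_ B₂ (c2 B₂ m (h z)) (g (c2 B₁ m z))
theorem6p4 m B₁ B₂ nonTrivial₁ _ h hom = coordinateMap , λ z → c1-hom z , c2-hom z
  where open Homomorphism B₁ B₂ m nonTrivial₁ h hom
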